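{- Let $(X,\Pi,\mathcal{B})$ be a group divisible design of strong dimension $d$, let $G_0\in\Pi$ be a group and let $Z\subsetneq G_0$ be a set of some, but not all, points of $G_0$. Let $\mathcal{B}'=\{B\setminus Z: B\in\mathcal{B},\ |B\setminus Z|\ge 2\}$ and $\Pi'=\{G\setminus Z: G\in\Pi\}$. Then $(X\setminus Z,\Pi',\mathcal{B}')$ is a group divisible design whose strong dimension is at least $d$.
   Context: A group divisible design (GDD) is a triple $(X,\Pi,\mathcal{B})$ where $\Pi$ is a partition of the finite point set $X$ into groups and $\mathcal{B}$ is a set of blocks (subsets of $X$ of size at least 2) such that a group and a block meet in at most one point and any two points in distinct groups lie in exactly one block. A strong subspace of a GDD is a subset $X'\subseteq X$ such that each group is contained in or disjoint from $X'$ and every block meeting $X'$ in at least two points is contained in $X'$; it is proper if it is disjoint from at least one group. The strong dimension of a GDD is the maximum $d$ such that every set of $d$ points is contained in a proper strong subspace. -}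

module Defs where

open import Data.Nat using (ℕ; _≤_; _≤?_)
open import Data.Fin using (Fin)
open import Data.Fin.Subset using (Subset; _∈_; _⊆_; _∩_; _─_; ∣_∣; Nonempty; Empty)
open import Data.List using (List; map; filter)
open import Data.List.Membership.Propositional using () renaming (_∈_ to _∈ₗ_)
open import Data.Product using (Σ; ∃; _×_)
open import Data.Sum using (_⊎_)
open import Relation.Binary.PropositionalEquality using (_≡_)
open import Relation.Nullary using (¬_)

-- A design lives inside the universe Fin n: point set X ⊆ Fin n,
-- groups Π and blocks ℬ are lists of subsets, read as SETS (set semantics).

SameGroup : ∀ {n} → List (Subset n) → Fin n → Fin n → Set
SameGroup Π x y = Σ _ λ G → G ∈ₗ Π × x ∈ G × y ∈ G

record IsGDD {n} (X : Subset n) (Π ℬ : List (Subset n)) : Set where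
  field
    group⊆X      : ∀ {G} → G ∈ₗ Π → G ⊆ X
    groupNonempty : ∀ {G} → G ∈ₗ Π → Nonempty G
    covers       : ∀ {x} → x ∈ X → Σ _ λ G → G ∈ₗ Π × x ∈ G
    disjointOrEq : ∀ {G G'} → G ∈ₗ Π → G' ∈ₗ Π → G ≡ G' ⊎ Empty (G ∩ G')
    block⊆X      : ∀ {B} → B ∈ₗ ℬ → B ⊆ X
    blockSize    : ∀ {B} → B ∈ₗ ℬ → 2 ≤ ∣ B ∣
    meet≤1       : ∀ {G B} → G ∈ₗ Π → B ∈ₗ ℬ → ∣ G ∩ B ∣ ≤ 1
    pairCovered  : ∀ {x y} → x ∈ X → y ∈ X → ¬ SameGroup Π x y →
                   Σ _ λ B → B ∈ₗ ℬ × x ∈ B × y ∈ B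
    pairUnique   : ∀ {x y B B'} → x ∈ X → y ∈ X → ¬ SameGroup Π x y →
                   B ∈ₗ ℬ → x ∈ B → y ∈ B → B' ∈ₗ ℬ → x ∈ B' → y ∈ B' → B ≡ B'

IsStrongSubspace : ∀ {n} → Subset n → List (Subset n) → List (Subset n) → Subset n → Set
IsStrongSubspace X Π ℬ S =
  S ⊆ X ×
  (∀ {G} → G ∈ₗ Π → G ⊆ S ⊎ Empty (G ∩ S)) ×
  (∀ {B} → B ∈ₗ ℬ → 2 ≤ ∣ B ∩ S ∣ → B ⊆ S)

IsProperStrongSubspace : ∀ {n} → Subset n → List (Subset n) → List (Subset n) → Subset n → Set
IsProperStrongSubspace X Π ℬ S =
  IsStrongSubspace X Π ℬ S × (Σ _ λ G → G ∈ₗ Π × Empty (G ∩ S))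

-- every set of d points (of X) is contained in a proper strong subspace;
-- d ranges over 0..|X| (sets of d points exist)
EveryDSetInProper : ∀ {n} → Subset n → List (Subset n) → List (Subset n) → ℕ → Set
EveryDSetInProper X Π ℬ d =
  d ≤ ∣ X ∣ ×
  (∀ T → T ⊆ X → ∣ T ∣ ≡ d →
     Σ _ λ S → IsProperStrongSubspace X Π ℬ S × T ⊆ S)

IsStrongDimension : ∀ {n} → Subset n → List (Subset n) → List (Subset n) → ℕ → Set
IsStrongDimension X Π ℬ d =
  EveryDSetInProper X Π ℬ d × (∀ e → EveryDSetInProper X Π ℬ e → e ≤ d)

deletePoints : ∀ {n} → Subset n → Subset n → Subset n
deletePoints X Z = X ─ Z

deleteGroups : ∀ {n} → List (Subset n) → Subset n → List (Subset n)
deleteGroups Π Z = map (λ G → G ─ Z) Π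

deleteBlocks : ∀ {n} → List (Subset n) → Subset n → List (Subset n)
deleteBlocks ℬ Z = filter (λ B → 2 ≤? ∣ B ∣) (map (λ B → B ─ Z) ℬ)

-- Deleting Z changes only the group G₀, which keeps a point of G₀ ∖ Z, so every group stays
-- nonempty and all GDD axioms survive. If S is a proper strong subspace, so is S ∖ Z: block and
-- group intersections only shrink, and the group missed by S is still missed. Hence every d-set of
-- X ∖ Z lies in a proper strong subspace of the derived design. Moreover d ≤ |X ∖ Z|, since
-- otherwise a d-set containing X ∖ Z would lie in a subspace meeting every group. The strong
-- dimension of the derived design is then the largest e ≤ |X ∖ Z| with this property, which exists
-- because the property is decidable.
module Submission where

open import Defs
open import Data.Nat using (ℕ; zero; suc; _≤_; _<_; _≤?_; _≟_; z≤n; s≤s)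
open import Data.Nat.Properties using (≤-trans; ≤-pred; ≤∧≢⇒<; n≤0⇒n≡0; <⇒≤; ≰⇒>)
open import Data.Fin.Subset
  using (Subset; inside; outside; _─_; _∩_; ∣_∣; _⊆_; _⊂_; _∉_; Nonempty; Empty)
  renaming (_∈_ to _∈ˢ_)
open import Data.Fin.Subset.Properties
  using ( _∈?_; _⊆?_; nonempty?; anySubset?; drop-∷-⊆; in⊆in; out⊆; p⊆q⇒∣p∣≤∣q∣
        ; x∈p∩q⁺; x∈p∩q⁻; p─q⊆p; x∈p∧x∉q⇒x∈p─q; x∈p∧x≢y⇒x∈p-y; x∈p⇒∣p-x∣<∣p∣ )
open import Data.List using (List)
open import Data.List.Membership.Propositional using (_∈_; find; lose)
open import Data.List.Membership.Propositional.Properties using (∈-map⁺; ∈-map⁻; ∈-filter⁺; ∈-filter⁻)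
open import Data.List.Relation.Unary.All as All using (all?)
open import Data.List.Relation.Unary.Any using (any?)
open import Data.Product using (Σ; _×_; _,_; proj₁; proj₂)
open import Data.Sum using (_⊎_; inj₁; inj₂)
open import Function using (_∘_)
open import Data.Vec using ([]; _∷_; here; there)
open import Relation.Nullary using (¬_; Dec; yes; no; contradiction)
open import Relation.Nullary.Decidable using (map′; _×-dec_; _→-dec_; _⊎-dec_; ¬?; decidable-stable)
open import Relation.Unary using (Decidable)
open import Relation.Binary.PropositionalEquality using (_≡_; _≢_; refl; sym; cong; subst)

private
  variable
    n : ℕ

x∈p─q⇒x∉q : ∀ (p q : Subset n) {x} → x ∈ˢ p ─ q → x ∉ q
x∈p─q⇒x∉q (inside ∷ p) (outside ∷ q) here        ()
x∈p─q⇒x∉q (_      ∷ p) (_       ∷ q) (there x∈) (there x∈q) = x∈p─q⇒x∉q p q x∈ x∈q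

─-monoˡ-⊆ : ∀ {p q : Subset n} r → p ⊆ q → p ─ r ⊆ q ─ r
─-monoˡ-⊆ {p = p} r p⊆q x∈ = x∈p∧x∉q⇒x∈p─q (p⊆q (p─q⊆p p r x∈)) (x∈p─q⇒x∉q p r x∈)

─-∩-⊆ : ∀ (p q r : Subset n) → (p ─ r) ∩ (q ─ r) ⊆ p ∩ q
─-∩-⊆ p q r x∈ =
  let x∈p─r , x∈q─r = x∈p∩q⁻ (p ─ r) (q ─ r) x∈
  in  x∈p∩q⁺ (p─q⊆p p r x∈p─r , p─q⊆p q r x∈q─r)

Empty-∩-─ : ∀ (p q r : Subset n) → Empty (p ∩ q) → Empty ((p ─ r) ∩ (q ─ r))
Empty-∩-─ p q r p∩q=∅ (x , x∈) = p∩q=∅ (x , ─-∩-⊆ p q r x∈)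

x∈p⇒0<∣p∣ : ∀ {p : Subset n} {x} → x ∈ˢ p → 0 < ∣ p ∣
x∈p⇒0<∣p∣ x∈p = ≤-trans (s≤s z≤n) (x∈p⇒∣p-x∣<∣p∣ x∈p)

x∈p∧y∈p∧x≢y⇒2≤∣p∣ : ∀ {p : Subset n} {x y} → x ∈ˢ p → y ∈ˢ p → x ≢ y → 2 ≤ ∣ p ∣
x∈p∧y∈p∧x≢y⇒2≤∣p∣ x∈p y∈p x≢y =
  ≤-trans (s≤s (x∈p⇒0<∣p∣ (x∈p∧x≢y⇒x∈p-y y∈p (x≢y ∘ sym)))) (x∈p⇒∣p-x∣<∣p∣ x∈p)

∃-⊆-between-of-size : ∀ (p q : Subset n) k → p ⊆ q → ∣ p ∣ ≤ k → k ≤ ∣ q ∣ →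
                      Σ (Subset n) λ r → p ⊆ r × r ⊆ q × ∣ r ∣ ≡ k
∃-⊆-between-of-size [] [] zero _ _ _ = [] , (λ ()) , (λ ()) , refl
∃-⊆-between-of-size (inside ∷ p) (outside ∷ q) k p⊆q _ _ = contradiction (p⊆q here) λ ()
∃-⊆-between-of-size (inside ∷ p) (inside ∷ q) (suc k) p⊆q (s≤s ∣p∣≤k) (s≤s k≤∣q∣) =
  let r , p⊆r , r⊆q , ∣r∣≡k = ∃-⊆-between-of-size p q k (drop-∷-⊆ p⊆q) ∣p∣≤k k≤∣q∣
  in  inside ∷ r , in⊆in p⊆r , in⊆in r⊆q , cong suc ∣r∣≡k
∃-⊆-between-of-size (outside ∷ p) (outside ∷ q) k p⊆q ∣p∣≤k k≤∣q∣ =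
  let r , p⊆r , r⊆q , ∣r∣≡k = ∃-⊆-between-of-size p q k (drop-∷-⊆ p⊆q) ∣p∣≤k k≤∣q∣
  in  outside ∷ r , out⊆ p⊆r , out⊆ r⊆q , ∣r∣≡k
∃-⊆-between-of-size (outside ∷ p) (inside ∷ q) k p⊆q ∣p∣≤k k≤1+∣q∣ with k ≤? ∣ q ∣
... | yes k≤∣q∣ =
  let r , p⊆r , r⊆q , ∣r∣≡k = ∃-⊆-between-of-size p q k (drop-∷-⊆ p⊆q) ∣p∣≤k k≤∣q∣
  in  outside ∷ r , out⊆ p⊆r , out⊆ r⊆q , ∣r∣≡k
... | no k≰∣q∣ with k | k≤1+∣q∣
...   | zero  | _ = contradiction z≤n k≰∣q∣
...   | suc k | s≤s k≤∣q∣ =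
  let ∣p∣≤k = ≤-trans (p⊆q⇒∣p∣≤∣q∣ (drop-∷-⊆ p⊆q)) (≤-pred (≰⇒> k≰∣q∣))
      r , p⊆r , r⊆q , ∣r∣≡k = ∃-⊆-between-of-size p q k (drop-∷-⊆ p⊆q) ∣p∣≤k k≤∣q∣
  in  inside ∷ r , out⊆ p⊆r , in⊆in r⊆q , cong suc ∣r∣≡k

∀∈? : ∀ {A : Set} {P : A → Set} → Decidable P → (xs : List A) → Dec (∀ {x} → x ∈ xs → P x)
∀∈? P? xs = map′ All.lookup All.tabulate (all? P? xs)

∃∈? : ∀ {A : Set} {P : A → Set} → Decidable P → (xs : List A) → Dec (Σ A λ x → x ∈ xs × P x)
∃∈? P? xs = map′ find (λ (_ , x∈xs , px) → lose x∈xs px) (any? P? xs)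

∀-Subset? : ∀ {P : Subset n → Set} → Decidable P → Dec (∀ p → P p)
∀-Subset? P? with anySubset? (¬? ∘ P?)
... | yes (p , ¬Pp) = no λ ∀P → ¬Pp (∀P p)
... | no ¬∃¬P       = yes λ p → decidable-stable (P? p) (λ ¬Pp → ¬∃¬P (p , ¬Pp))

Empty? : Decidable (Empty {n})
Empty? p = ¬? (nonempty? p)

IsProperStrongSubspace? : ∀ (X : Subset n) Π ℬ → Decidable (IsProperStrongSubspace X Π ℬ)
IsProperStrongSubspace? X Π ℬ S =
  ((S ⊆? X)
    ×-dec ∀∈? (λ G → (G ⊆? S) ⊎-dec Empty? (G ∩ S)) Π
    ×-dec ∀∈? (λ B → (2 ≤? ∣ B ∩ S ∣) →-dec (B ⊆? S)) ℬ)
  ×-dec ∃∈? (λ G → Empty? (G ∩ S)) Π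

EveryDSetInProper? : ∀ (X : Subset n) Π ℬ → Decidable (EveryDSetInProper X Π ℬ)
EveryDSetInProper? X Π ℬ d =
  (d ≤? ∣ X ∣) ×-dec ∀-Subset? λ T → (T ⊆? X) →-dec (∣ T ∣ ≟ d) →-dec
    anySubset? λ S → IsProperStrongSubspace? X Π ℬ S ×-dec (T ⊆? S)

greatest : ∀ {P : ℕ → Set} → Decidable P → ∀ {d} k → P d → (∀ e → P e → e ≤ k) →
           Σ ℕ λ m → (P m × (∀ e → P e → e ≤ m)) × d ≤ m
greatest {P} P? k Pd bound with P? k
... | yes Pk = k , (Pk , bound) , bound _ Pd
greatest {P} P? zero    Pd bound | no ¬Pk = contradiction (subst P (n≤0⇒n≡0 (bound _ Pd)) Pd) ¬Pk
greatest {P} P? (suc k) Pd bound | no ¬Pk =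
  greatest P? k Pd λ e Pe → ≤-pred (≤∧≢⇒< (bound e Pe) λ { refl → ¬Pk Pe })

module Deletion {n} {X : Subset n} {Π ℬ : List (Subset n)} {G₀ Z : Subset n}
                (gdd : IsGDD X Π ℬ) (G₀∈Π : G₀ ∈ Π) (Z⊂G₀ : Z ⊂ G₀) where

  open IsGDD gdd

  X' : Subset n
  X' = deletePoints X Z

  Π' ℬ' : List (Subset n)
  Π' = deleteGroups Π Z
  ℬ' = deleteBlocks ℬ Z

  ∈X'⁻ : ∀ {x} → x ∈ˢ X' → x ∈ˢ X × x ∉ Z
  ∈X'⁻ x∈X' = p─q⊆p X Z x∈X' , x∈p─q⇒x∉q X Z x∈X'

  ─Z∈Π' : ∀ {G} → G ∈ Π → G ─ Z ∈ Π'
  ─Z∈Π' = ∈-map⁺ (_─ Z)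

  ∈Π'⁻ : ∀ {G'} → G' ∈ Π' → Σ _ λ G → G ∈ Π × G' ≡ G ─ Z
  ∈Π'⁻ = ∈-map⁻ (_─ Z)

  ─Z∈ℬ' : ∀ {B} → B ∈ ℬ → 2 ≤ ∣ B ─ Z ∣ → B ─ Z ∈ ℬ'
  ─Z∈ℬ' B∈ℬ = ∈-filter⁺ (λ B → 2 ≤? ∣ B ∣) (∈-map⁺ (_─ Z) B∈ℬ)

  ∈ℬ'⁻ : ∀ {B'} → B' ∈ ℬ' → (Σ _ λ B → B ∈ ℬ × B' ≡ B ─ Z) × 2 ≤ ∣ B' ∣
  ∈ℬ'⁻ B'∈ℬ' = let B'∈ , 2≤∣B'∣ = ∈-filter⁻ (λ B → 2 ≤? ∣ B ∣) B'∈ℬ' in ∈-map⁻ (_─ Z) B'∈ , 2≤∣B'∣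

  meets-Z⇒≡G₀ : ∀ {G x} → G ∈ Π → x ∈ˢ G → x ∈ˢ Z → G ≡ G₀
  meets-Z⇒≡G₀ {x = x} G∈Π x∈G x∈Z with disjointOrEq G∈Π G₀∈Π
  ... | inj₁ G≡G₀   = G≡G₀
  ... | inj₂ G∩G₀=∅ = contradiction (x , x∈p∩q⁺ (x∈G , proj₁ Z⊂G₀ x∈Z)) G∩G₀=∅

  SameGroup-─Z : ∀ {x y} → x ∉ Z → y ∉ Z → SameGroup Π x y → SameGroup Π' x y
  SameGroup-─Z x∉Z y∉Z (G , G∈Π , x∈G , y∈G) =
    G ─ Z , ─Z∈Π' G∈Π , x∈p∧x∉q⇒x∈p─q x∈G x∉Z , x∈p∧x∉q⇒x∈p─q y∈G y∉Z

  group⊆X' : ∀ {G'} → G' ∈ Π' → G' ⊆ X'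
  group⊆X' G'∈Π' with ∈Π'⁻ G'∈Π'
  ... | G , G∈Π , refl = ─-monoˡ-⊆ Z (group⊆X G∈Π)

  groupNonempty' : ∀ {G'} → G' ∈ Π' → Nonempty G'
  groupNonempty' G'∈Π' with ∈Π'⁻ G'∈Π'
  ... | G , G∈Π , refl with groupNonempty G∈Π
  ...   | x , x∈G with x ∈? Z
  ...     | no x∉Z = x , x∈p∧x∉q⇒x∈p─q x∈G x∉Z
  ...     | yes x∈Z =
    let _ , w , w∈G₀ , w∉Z = Z⊂G₀
    in  w , x∈p∧x∉q⇒x∈p─q (subst (w ∈ˢ_) (sym (meets-Z⇒≡G₀ G∈Π x∈G x∈Z)) w∈G₀) w∉Z

  covers' : ∀ {x} → x ∈ˢ X' → Σ _ λ G' → G' ∈ Π' × x ∈ˢ G'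
  covers' x∈X' with ∈X'⁻ x∈X'
  ... | x∈X , x∉Z with covers x∈X
  ...   | G , G∈Π , x∈G = G ─ Z , ─Z∈Π' G∈Π , x∈p∧x∉q⇒x∈p─q x∈G x∉Z

  disjointOrEq' : ∀ {G' H'} → G' ∈ Π' → H' ∈ Π' → G' ≡ H' ⊎ Empty (G' ∩ H')
  disjointOrEq' G'∈Π' H'∈Π' with ∈Π'⁻ G'∈Π' | ∈Π'⁻ H'∈Π'
  ... | G , G∈Π , refl | H , H∈Π , refl with disjointOrEq G∈Π H∈Π
  ...   | inj₁ refl   = inj₁ refl
  ...   | inj₂ G∩H=∅ = inj₂ (Empty-∩-─ G H Z G∩H=∅)

  block⊆X' : ∀ {B'} → B' ∈ ℬ' → B' ⊆ X'
  block⊆X' B'∈ℬ' with ∈ℬ'⁻ B'∈ℬ'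
  ... | (B , B∈ℬ , refl) , _ = ─-monoˡ-⊆ Z (block⊆X B∈ℬ)

  meet≤1' : ∀ {G' B'} → G' ∈ Π' → B' ∈ ℬ' → ∣ G' ∩ B' ∣ ≤ 1
  meet≤1' G'∈Π' B'∈ℬ' with ∈Π'⁻ G'∈Π' | ∈ℬ'⁻ B'∈ℬ'
  ... | G , G∈Π , refl | (B , B∈ℬ , refl) , _ =
    ≤-trans (p⊆q⇒∣p∣≤∣q∣ (─-∩-⊆ G B Z)) (meet≤1 G∈Π B∈ℬ)

  pairCovered' : ∀ {x y} → x ∈ˢ X' → y ∈ˢ X' → ¬ SameGroup Π' x y →
                 Σ _ λ B' → B' ∈ ℬ' × x ∈ˢ B' × y ∈ˢ B'
  pairCovered' {x} {y} x∈X' y∈X' ¬same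
    with ∈X'⁻ x∈X' | ∈X'⁻ y∈X'
  ... | x∈X , x∉Z | y∈X , y∉Z
    with pairCovered x∈X y∈X (¬same ∘ SameGroup-─Z x∉Z y∉Z)
  ...   | B , B∈ℬ , x∈B , y∈B = B ─ Z , ─Z∈ℬ' B∈ℬ 2≤∣B─Z∣ , x∈B─Z , y∈B─Z
    where
    x∈B─Z : x ∈ˢ B ─ Z
    x∈B─Z = x∈p∧x∉q⇒x∈p─q x∈B x∉Z
    y∈B─Z : y ∈ˢ B ─ Z
    y∈B─Z = x∈p∧x∉q⇒x∈p─q y∈B y∉Z
    x≢y : x ≢ y
    x≢y refl = let G' , G'∈Π' , x∈G' = covers' x∈X' in ¬same (G' , G'∈Π' , x∈G' , x∈G')
    2≤∣B─Z∣ : 2 ≤ ∣ B ─ Z ∣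
    2≤∣B─Z∣ = x∈p∧y∈p∧x≢y⇒2≤∣p∣ x∈B─Z y∈B─Z x≢y

  pairUnique' : ∀ {x y B' C'} → x ∈ˢ X' → y ∈ˢ X' → ¬ SameGroup Π' x y →
                B' ∈ ℬ' → x ∈ˢ B' → y ∈ˢ B' → C' ∈ ℬ' → x ∈ˢ C' → y ∈ˢ C' → B' ≡ C'
  pairUnique' x∈X' y∈X' ¬same B'∈ℬ' x∈B' y∈B' C'∈ℬ' x∈C' y∈C'
    with ∈X'⁻ x∈X' | ∈X'⁻ y∈X' | ∈ℬ'⁻ B'∈ℬ' | ∈ℬ'⁻ C'∈ℬ'
  ... | x∈X , x∉Z | y∈X , y∉Z | (B , B∈ℬ , refl) , _ | (C , C∈ℬ , refl) , _ =
    cong (_─ Z) (pairUnique x∈X y∈X (¬same ∘ SameGroup-─Z x∉Z y∉Z)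
      B∈ℬ (p─q⊆p B Z x∈B') (p─q⊆p B Z y∈B') C∈ℬ (p─q⊆p C Z x∈C') (p─q⊆p C Z y∈C'))

  isGDD : IsGDD X' Π' ℬ'
  isGDD = record
    { group⊆X       = group⊆X'
    ; groupNonempty = groupNonempty'
    ; covers        = covers'
    ; disjointOrEq  = disjointOrEq'
    ; block⊆X       = block⊆X'
    ; blockSize     = λ B'∈ℬ' → proj₂ (∈ℬ'⁻ B'∈ℬ')
    ; meet≤1        = meet≤1'
    ; pairCovered   = pairCovered'
    ; pairUnique    = pairUnique'
    }

  ─Z-isProperStrongSubspace : ∀ {S} → IsProperStrongSubspace X Π ℬ S →
                              IsProperStrongSubspace X' Π' ℬ' (S ─ Z)
  ─Z-isProperStrongSubspace {S} ((S⊆X , groupInOrOut , blockClosed) , H , H∈Π , H∩S=∅) =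
    (─-monoˡ-⊆ Z S⊆X , groupInOrOut' , blockClosed') ,
    H ─ Z , ─Z∈Π' H∈Π , Empty-∩-─ H S Z H∩S=∅
    where
    groupInOrOut' : ∀ {G'} → G' ∈ Π' → G' ⊆ S ─ Z ⊎ Empty (G' ∩ (S ─ Z))
    groupInOrOut' G'∈Π' with ∈Π'⁻ G'∈Π'
    ... | G , G∈Π , refl with groupInOrOut G∈Π
    ...   | inj₁ G⊆S   = inj₁ (─-monoˡ-⊆ Z G⊆S)
    ...   | inj₂ G∩S=∅ = inj₂ (Empty-∩-─ G S Z G∩S=∅)

    blockClosed' : ∀ {B'} → B' ∈ ℬ' → 2 ≤ ∣ B' ∩ (S ─ Z) ∣ → B' ⊆ S ─ Z
    blockClosed' B'∈ℬ' 2≤∣B'∩S'∣ with ∈ℬ'⁻ B'∈ℬ'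
    ... | (B , B∈ℬ , refl) , _ =
      ─-monoˡ-⊆ Z (blockClosed B∈ℬ (≤-trans 2≤∣B'∩S'∣ (p⊆q⇒∣p∣≤∣q∣ (─-∩-⊆ B S Z))))

  EveryDSetInProper⇒≤∣X'∣ : ∀ {d} → EveryDSetInProper X Π ℬ d → d ≤ ∣ X' ∣
  EveryDSetInProper⇒≤∣X'∣ {d} (d≤∣X∣ , inProper) with d ≤? ∣ X' ∣
  ... | yes d≤∣X'∣ = d≤∣X'∣
  ... | no d≰∣X'∣
    with ∃-⊆-between-of-size X' X d (p─q⊆p X Z) (<⇒≤ (≰⇒> d≰∣X'∣)) d≤∣X∣
  ...   | T , X'⊆T , T⊆X , ∣T∣≡d
    with inProper T T⊆X ∣T∣≡d
  ...     | S , (_ , H , H∈Π , H∩S=∅) , T⊆S =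
    let h , h∈H─Z = groupNonempty' (─Z∈Π' H∈Π)
    in  contradiction (h , x∈p∩q⁺ (p─q⊆p H Z h∈H─Z , T⊆S (X'⊆T (group⊆X' (─Z∈Π' H∈Π) h∈H─Z))))
                      H∩S=∅

  everyDSetInProper : ∀ {d} → EveryDSetInProper X Π ℬ d → EveryDSetInProper X' Π' ℬ' d
  everyDSetInProper {d} P@(_ , inProper) = EveryDSetInProper⇒≤∣X'∣ P , inProper'
    where
    inProper' : ∀ T → T ⊆ X' → ∣ T ∣ ≡ d →
                Σ _ λ S' → IsProperStrongSubspace X' Π' ℬ' S' × T ⊆ S'
    inProper' T T⊆X' ∣T∣≡d =
      let S , S-proper , T⊆S = inProper T (proj₁ ∘ ∈X'⁻ ∘ T⊆X') ∣T∣≡d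
      in  S ─ Z , ─Z-isProperStrongSubspace S-proper ,
          λ x∈T → x∈p∧x∉q⇒x∈p─q (T⊆S x∈T) (proj₂ (∈X'⁻ (T⊆X' x∈T)))

mainTheorem6 : ∀ {n} (X : Subset n) (Π ℬ : List (Subset n)) (d : ℕ) (G₀ Z : Subset n) →
  IsGDD X Π ℬ → IsStrongDimension X Π ℬ d →
  G₀ ∈ Π → Nonempty Z → Z ⊂ G₀ →
  IsGDD (deletePoints X Z) (deleteGroups Π Z) (deleteBlocks ℬ Z) ×
  (Σ ℕ λ d' → IsStrongDimension (deletePoints X Z) (deleteGroups Π Z) (deleteBlocks ℬ Z) d' × d ≤ d')
mainTheorem6 X Π ℬ d G₀ Z gdd (dimension-d , _) G₀∈Π _ Z⊂G₀ =
  isGDD ,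
  greatest (EveryDSetInProper? X' Π' ℬ') ∣ X' ∣ (everyDSetInProper dimension-d) (λ _ → proj₁)
  where open Deletion gdd G₀∈Π Z⊂G₀
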